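{- There exist Boolean functions $f_n\in\mathbb{MM}_n$ (for $n\to\infty$) with real polynomial degree $\mathrm{pdeg}(f_n)=n-\Theta(\log n)$.
   Context: $\mathbb{MM}_n$ is the set of functions $f:\mathbb{F}_2^{n_1}\times\mathbb{F}_2^{n_2}\to\mathbb{F}_2$, $n_1+n_2=n$, of the form $f(\mathbf{x},\mathbf{y})=(\phi(\mathbf{x})\cdot\mathbf{y})\oplus g(\mathbf{x})$ with $\phi:\mathbb{F}_2^{n_1}\to\mathbb{F}_2^{n_2}$, $g:\mathbb{F}_2^{n_1}\to\mathbb{F}_2$, such that $\phi(\mathbf{1}_{n_1})=\mathbf{1}_{n_2}$, $g(\mathbf{1}_{n_1})=0$, and for each $1\le i\le n_1$, $\phi(\mathbf{1}_{n_1}^i)$ has odd Hamming weight and $g(\mathbf{1}_{n_1}^i)\equiv n_2\pmod2$ (here $\mathbf{1}_m$ is the all-ones vector and $\mathbf{1}_{n_1}^i$ is $\mathbf{1}_{n_1}$ with the $i$-th bit flipped). Every function in $\mathbb{MM}_n$ has sensitivity $n$. $\mathrm{pdeg}$ is the real polynomial degree. -}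

module Defs where

open import Data.Bool using (Bool; true; false; not; _∧_; _xor_; if_then_else_)
open import Data.Nat using (ℕ; zero; suc; _+_; _%_)
open import Data.Fin using (Fin; _↑ˡ_; _↑ʳ_)
import Data.Fin as Fin
open import Data.Integer using (ℤ; 0ℤ; 1ℤ) renaming (_+_ to _+ℤ_; _*_ to _*ℤ_)
open import Data.List using (List; []; _∷_; concatMap)
open import Data.Product using (Σ; ∃; ∃-syntax; _×_; _,_)
open import Relation.Binary.PropositionalEquality using (_≡_; _≢_)
open import Relation.Nullary using (does)

BVec : ℕ → Set
BVec n = Fin n → Bool

cons : ∀ {n} → Bool → BVec n → BVec (suc n)
cons b v Fin.zero    = b
cons b v (Fin.suc i) = v i

tail : ∀ {n} → BVec (suc n) → BVec n
tail v i = v (Fin.suc i)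

allVecs : ∀ n → List (BVec n)
allVecs zero    = (λ ()) ∷ []
allVecs (suc n) = concatMap (λ v → cons false v ∷ cons true v ∷ []) (allVecs n)

hw : ∀ {n} → BVec n → ℕ
hw {zero}  v = 0
hw {suc n} v = (if v Fin.zero then 1 else 0) + hw (tail v)

dot : ∀ {n} → BVec n → BVec n → Bool
dot {zero}  u v = false
dot {suc n} u v = (u Fin.zero ∧ v Fin.zero) xor dot (tail u) (tail v)

ones : ∀ {m} → BVec m
ones _ = true

flipAt : ∀ {m} → Fin m → BVec m
flipAt i j = not (does (i Fin.≟ j))

bool→ℕ : Bool → ℕ
bool→ℕ true  = 1
bool→ℕ false = 0

bool→ℤ : Bool → ℤ
bool→ℤ true  = 1ℤ
bool→ℤ false = 0ℤ

mmFun : ∀ n₁ n₂ → (BVec n₁ → BVec n₂) → (BVec n₁ → Bool) → BVec (n₁ + n₂) → Bool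
mmFun n₁ n₂ φ g z = dot (φ x) y xor g x
  where
  x : BVec n₁
  x i = z (i ↑ˡ n₂)
  y : BVec n₂
  y j = z (n₁ ↑ʳ j)

IsMM : ∀ n₁ n₂ → (BVec n₁ → BVec n₂) → (BVec n₁ → Bool) → Set
IsMM n₁ n₂ φ g =
  (∀ j → φ ones j ≡ true)
  × g ones ≡ false
  × (∀ i → hw (φ (flipAt i)) % 2 ≡ 1)
  × (∀ i → bool→ℕ (g (flipAt i)) ≡ n₂ % 2)

-- Multilinear polynomials in n variables: a coefficient c_S for every S ⊆ [n]
-- (S given by its indicator vector). Value of the monomial x^S at a 0/1 point.
monoVal : ∀ {n} → BVec n → BVec n → ℤ
monoVal {zero}  S x = 1ℤ
monoVal {suc n} S x =
  (if S Fin.zero then bool→ℤ (x Fin.zero) else 1ℤ) *ℤ monoVal (tail S) (tail x)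

sumℤ : List ℤ → ℤ
sumℤ []       = 0ℤ
sumℤ (a ∷ as) = a +ℤ sumℤ as

mapL : ∀ {A B : Set} → (A → B) → List A → List B
mapL f []       = []
mapL f (a ∷ as) = f a ∷ mapL f as

evalPoly : ∀ {n} → (BVec n → ℤ) → BVec n → ℤ
evalPoly {n} c x = sumℤ (mapL (λ S → c S *ℤ monoVal S x) (allVecs n))

-- pdeg f = d : f is represented on {0,1}^n by a multilinear polynomial
-- (with integer coefficients; the unique real representation is integral)
-- whose degree is exactly d.
HasPDeg : ∀ {n} → (BVec n → Bool) → ℕ → Set
HasPDeg {n} f d = ∃[ c ]
  ( (∀ x → evalPoly c x ≡ bool→ℤ (f x))
  × (∃[ S ] (c S ≢ 0ℤ × hw S ≡ d))
  × (∀ S → c S ≢ 0ℤ → hw S Data.Nat.≤ d) )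

-- Take φ constant 1 and g the XOR of B + 1 disjoint copies of NAE(x₀, x₁, x₂), so that
-- f(x, y) = g(x) ⊕ y₁ ⊕ ⋯ ⊕ y_{n₂}. Over the reals a ⊕ b = a + b - 2ab, and for functions of
-- disjoint sets of variables the top monomials multiply, so degrees add: pdeg f = 2(B + 1) + n₂
-- while n = 3(B + 1) + n₂, i.e. n - pdeg f = B + 1. The MM side conditions hold because
-- NAE(1, 1, 1) = 0 and flipping one bit of 1 makes exactly one block non-constant. Taking
-- B + 1 ∈ {⌊log₂ n⌋, ⌊log₂ n⌋ + 1} so that n₂ is odd gives n - pdeg f = Θ(log n).

module Submission where

open import Defs
open import Data.Bool using (Bool; true; false; not; _xor_; if_then_else_)
open import Data.Bool.Properties using (xor-comm)
open import Data.Fin as Fin using (Fin; _↑ˡ_; _↑ʳ_; splitAt)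
open import Data.Fin.Properties
  using (↑ˡ-injective; ↑ʳ-injective; splitAt-↑ˡ; splitAt-↑ʳ; splitAt⁻¹-↑ˡ; splitAt⁻¹-↑ʳ)
open import Data.Integer as ℤ using (ℤ; 0ℤ; 1ℤ; -1ℤ; -[1+_]) renaming (_+_ to _+ℤ_; _*_ to _*ℤ_)
import Data.Integer.Properties as ℤP
open import Data.Integer.Tactic.RingSolver using (solve-∀)
open import Data.List using ([]; _∷_; concatMap)
open import Data.Nat using (ℕ; zero; suc; _+_; _*_; _∸_; _^_; _≤_; _<_; _%_; z≤n; s≤s; ⌊_/2⌋)
import Data.Nat.Properties as ℕP
open import Data.Nat.DivMod using ([m+kn]%n≡m%n)
open import Data.Nat.Logarithm using (⌊log₂_⌋; ⌊log₂⌋-mono-≤)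
open import Data.Nat.Logarithm.Core using (⌊log2⌋)
open import Data.Nat.Tactic.RingSolver using () renaming (solve-∀ to solveℕ-∀)
open import Data.Product using (∃; ∃-syntax; _×_; _,_)
open import Data.Sum using (_⊎_; inj₁; inj₂)
open import Data.Vec.Functional using (_++_; take; drop)
open import Data.Vec.Functional.Properties using (lookup-++ˡ; lookup-++ʳ)
open import Function using (_∘_; mk⇔)
open import Induction.WellFounded using (Acc; acc)
open import Relation.Binary.PropositionalEquality
open import Relation.Nullary using (does; yes; no; contradiction)
open import Relation.Nullary.Decidable using (dec-false; does-⇔)

sumℤ-cong : ∀ {A : Set} {f g : A → ℤ} → f ≗ g → ∀ xs → sumℤ (mapL f xs) ≡ sumℤ (mapL g xs)
sumℤ-cong f≗g []       = refl
sumℤ-cong f≗g (x ∷ xs) = cong₂ _+ℤ_ (f≗g x) (sumℤ-cong f≗g xs)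

sumℤ-+ : ∀ {A : Set} (f g : A → ℤ) xs →
  sumℤ (mapL (λ x → f x +ℤ g x) xs) ≡ sumℤ (mapL f xs) +ℤ sumℤ (mapL g xs)
sumℤ-+ f g []       = refl
sumℤ-+ f g (x ∷ xs) rewrite sumℤ-+ f g xs = interchange (f x) (g x) _ _
  where
  interchange : ∀ a b c d → a +ℤ b +ℤ (c +ℤ d) ≡ a +ℤ c +ℤ (b +ℤ d)
  interchange = solve-∀

sumℤ-*ˡ : ∀ {A : Set} k (f : A → ℤ) xs → sumℤ (mapL (λ x → k *ℤ f x) xs) ≡ k *ℤ sumℤ (mapL f xs)
sumℤ-*ˡ k f []       = sym (ℤP.*-zeroʳ k)
sumℤ-*ˡ k f (x ∷ xs) rewrite sumℤ-*ˡ k f xs = sym (ℤP.*-distribˡ-+ k (f x) _)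

sumℤ-concatMap-pair : ∀ {A B : Set} (h : B → ℤ) (f g : A → B) xs →
  sumℤ (mapL h (concatMap (λ x → f x ∷ g x ∷ []) xs))
    ≡ sumℤ (mapL (h ∘ f) xs) +ℤ sumℤ (mapL (h ∘ g) xs)
sumℤ-concatMap-pair h f g []       = refl
sumℤ-concatMap-pair h f g (x ∷ xs) rewrite sumℤ-concatMap-pair h f g xs = shuffle (h (f x)) (h (g x)) _ _
  where
  shuffle : ∀ a b c d → a +ℤ (b +ℤ (c +ℤ d)) ≡ a +ℤ c +ℤ (b +ℤ d)
  shuffle = solve-∀

evalPoly-cong : ∀ {n} {c c′ : BVec n → ℤ} → c ≗ c′ → ∀ x → evalPoly c x ≡ evalPoly c′ x
evalPoly-cong {n} c≗c′ x = sumℤ-cong (λ S → cong (_*ℤ monoVal S x) (c≗c′ S)) (allVecs n)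

evalPoly-+ : ∀ {n} (c c′ : BVec n → ℤ) x →
  evalPoly (λ S → c S +ℤ c′ S) x ≡ evalPoly c x +ℤ evalPoly c′ x
evalPoly-+ {n} c c′ x =
  trans (sumℤ-cong (λ S → ℤP.*-distribʳ-+ (monoVal S x) (c S) (c′ S)) (allVecs n)) (sumℤ-+ _ _ (allVecs n))

evalPoly-*ˡ : ∀ {n} k (c : BVec n → ℤ) x → evalPoly (λ S → k *ℤ c S) x ≡ k *ℤ evalPoly c x
evalPoly-*ˡ {n} k c x =
  trans (sumℤ-cong (λ S → ℤP.*-assoc k (c S) _) (allVecs n)) (sumℤ-*ˡ k _ (allVecs n))

evalPoly-zero : ∀ {n} (x : BVec n) → evalPoly (λ _ → 0ℤ) x ≡ 0ℤ
evalPoly-zero x = evalPoly-*ˡ 0ℤ (λ _ → 0ℤ) x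

evalPoly-cons : ∀ {n} (c : BVec (suc n) → ℤ) x →
  evalPoly c x ≡ evalPoly (c ∘ cons false) (tail x) +ℤ bool→ℤ (x Fin.zero) *ℤ evalPoly (c ∘ cons true) (tail x)
evalPoly-cons {n} c x =
  trans (sumℤ-concatMap-pair (λ S → c S *ℤ monoVal S x) (cons false) (cons true) (allVecs n))
    (cong₂ _+ℤ_
      (sumℤ-cong (λ S → cong (c (cons false S) *ℤ_) (ℤP.*-identityˡ _)) (allVecs n))
      (trans (sumℤ-cong (λ S → swap (c (cons true S)) x₀ _) (allVecs n)) (sumℤ-*ˡ x₀ _ (allVecs n))))
  where
  x₀ = bool→ℤ (x Fin.zero)
  swap : ∀ a b m → a *ℤ (b *ℤ m) ≡ b *ℤ (a *ℤ m)
  swap = solve-∀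

Extensional : ∀ {n} {A : Set} → (BVec n → A) → Set
Extensional a = ∀ {u v} → u ≗ v → a u ≡ a v

hw-ext : ∀ {n} → Extensional (hw {n})
hw-ext {zero}  u≗v = refl
hw-ext {suc n} u≗v = cong₂ (λ b m → (if b then 1 else 0) + m) (u≗v Fin.zero) (hw-ext (u≗v ∘ Fin.suc))

hw-take-drop : ∀ k {n} (S : BVec (k + n)) → hw S ≡ hw (take k S) + hw (drop k S)
hw-take-drop zero    S = refl
hw-take-drop (suc k) S =
  trans (cong (s₀ +_) (hw-take-drop k (tail S))) (sym (ℕP.+-assoc s₀ _ _))
  where s₀ = if S Fin.zero then 1 else 0

hw-++ : ∀ {k n} (u : BVec k) (v : BVec n) → hw (u ++ v) ≡ hw u + hw v
hw-++ {k} u v =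
  trans (hw-take-drop k (u ++ v)) (cong₂ _+_ (hw-ext (lookup-++ˡ u v)) (hw-ext (lookup-++ʳ u v)))

hw-ones : ∀ n → hw {n} ones ≡ n
hw-ones zero    = refl
hw-ones (suc n) = cong suc (hw-ones n)

infixl 7 _⊗_
_⊗_ : ∀ {k n} → (BVec k → ℤ) → (BVec n → ℤ) → BVec (k + n) → ℤ
_⊗_ {k} a b S = a (take k S) *ℤ b (drop k S)

evalPoly-⊗ : ∀ k {n} {a : BVec k → ℤ} → Extensional a → (b : BVec n → ℤ) → ∀ z →
  evalPoly (a ⊗ b) z ≡ evalPoly a (take k z) *ℤ evalPoly b (drop k z)
evalPoly-⊗ zero {a = a} a-ext b z = begin
  evalPoly (a ⊗ b) z                        ≡⟨ evalPoly-cong (λ S → cong (_*ℤ b S) (a-ext (λ ()))) z ⟩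
  evalPoly (λ S → a₀ *ℤ b S) z              ≡⟨ evalPoly-*ˡ a₀ b z ⟩
  a₀ *ℤ evalPoly b z                        ≡⟨ cong (_*ℤ evalPoly b z) (sym (evalPoly-const (take zero z))) ⟩
  evalPoly a (take zero z) *ℤ evalPoly b z  ∎
  where
  open ≡-Reasoning
  a₀ = a (λ ())
  evalPoly-const : ∀ x → evalPoly a x ≡ a₀
  evalPoly-const x = trans (ℤP.+-identityʳ _) (trans (ℤP.*-identityʳ _) (a-ext (λ ())))
evalPoly-⊗ (suc k) {a = a} a-ext b z = begin
  evalPoly (a ⊗ b) z
    ≡⟨ evalPoly-cons (a ⊗ b) z ⟩
  evalPoly ((a ⊗ b) ∘ cons false) (tail z) +ℤ z₀ *ℤ evalPoly ((a ⊗ b) ∘ cons true) (tail z)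
    ≡⟨ cong₂ (λ p q → p +ℤ z₀ *ℤ q) (evalPoly-cong (⊗-cons false) (tail z))
                                     (evalPoly-cong (⊗-cons true) (tail z)) ⟩
  evalPoly ((a ∘ cons false) ⊗ b) (tail z) +ℤ z₀ *ℤ evalPoly ((a ∘ cons true) ⊗ b) (tail z)
    ≡⟨ cong₂ (λ p q → p +ℤ z₀ *ℤ q) (evalPoly-⊗ k (a-ext ∘ cons-ext false) b (tail z))
                                     (evalPoly-⊗ k (a-ext ∘ cons-ext true) b (tail z)) ⟩
  A₀ *ℤ B +ℤ z₀ *ℤ (A₁ *ℤ B)
    ≡⟨ factor A₀ z₀ A₁ B ⟩
  (A₀ +ℤ z₀ *ℤ A₁) *ℤ B
    ≡⟨ cong (_*ℤ B) (sym (evalPoly-cons a (take (suc k) z))) ⟩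
  evalPoly a (take (suc k) z) *ℤ B ∎
  where
  open ≡-Reasoning
  z₀ = bool→ℤ (z Fin.zero)
  A₀ = evalPoly (a ∘ cons false) (take k (tail z))
  A₁ = evalPoly (a ∘ cons true) (take k (tail z))
  B  = evalPoly b (drop (suc k) z)
  cons-ext : ∀ β {u v : BVec k} → u ≗ v → cons β u ≗ cons β v
  cons-ext β u≗v Fin.zero    = refl
  cons-ext β u≗v (Fin.suc i) = u≗v i
  ⊗-cons : ∀ β → (a ⊗ b) ∘ cons β ≗ (a ∘ cons β) ⊗ b
  ⊗-cons β S = cong (_*ℤ _) (a-ext λ { Fin.zero → refl ; (Fin.suc i) → refl })
  factor : ∀ p x q b → p *ℤ b +ℤ x *ℤ (q *ℤ b) ≡ (p +ℤ x *ℤ q) *ℤ b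
  factor = solve-∀

one : ∀ {n} → BVec n → ℤ
one S = if does (hw S ℕP.≟ 0) then 1ℤ else 0ℤ

one-ext : ∀ {n} → Extensional (one {n})
one-ext u≗v = cong (λ m → if does (m ℕP.≟ 0) then 1ℤ else 0ℤ) (hw-ext u≗v)

one-≡0 : ∀ {n} (S : BVec n) → hw S ≢ 0 → one S ≡ 0ℤ
one-≡0 S hw≢0 = cong (if_then 1ℤ else 0ℤ) (dec-false (hw S ℕP.≟ 0) hw≢0)

evalPoly-one : ∀ {n} (x : BVec n) → evalPoly one x ≡ 1ℤ
evalPoly-one {zero}  x = refl
evalPoly-one {suc n} x = begin
  evalPoly one x
    ≡⟨ evalPoly-cons one x ⟩
  evalPoly one (tail x) +ℤ x₀ *ℤ evalPoly (λ _ → 0ℤ) (tail x)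
    ≡⟨ cong₂ (λ p q → p +ℤ x₀ *ℤ q) (evalPoly-one (tail x)) (evalPoly-zero (tail x)) ⟩
  1ℤ +ℤ x₀ *ℤ 0ℤ
    ≡⟨ cong (1ℤ +ℤ_) (ℤP.*-zeroʳ x₀) ⟩
  1ℤ ∎
  where
  open ≡-Reasoning
  x₀ = bool→ℤ (x Fin.zero)

infixl 6 _⊕_
_⊕_ : ∀ {k n} → (BVec k → ℤ) → (BVec n → ℤ) → BVec (k + n) → ℤ
(a ⊕ b) S = (a ⊗ one) S +ℤ (one ⊗ b) S +ℤ -[1+ 1 ] *ℤ (a ⊗ b) S

⊗-ext : ∀ {k n} {a : BVec k → ℤ} {b : BVec n → ℤ} → Extensional a → Extensional b → Extensional (a ⊗ b)
⊗-ext {k} a-ext b-ext u≗v = cong₂ _*ℤ_ (a-ext (u≗v ∘ (_↑ˡ _))) (b-ext (u≗v ∘ (k ↑ʳ_)))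

⊕-ext : ∀ {k n} {a : BVec k → ℤ} {b : BVec n → ℤ} → Extensional a → Extensional b → Extensional (a ⊕ b)
⊕-ext a-ext b-ext u≗v =
  cong₂ _+ℤ_ (cong₂ _+ℤ_ (⊗-ext a-ext one-ext u≗v) (⊗-ext one-ext b-ext u≗v))
             (cong (-[1+ 1 ] *ℤ_) (⊗-ext a-ext b-ext u≗v))

Represents : ∀ {n} → (BVec n → ℤ) → (BVec n → Bool) → Set
Represents c f = ∀ x → evalPoly c x ≡ bool→ℤ (f x)

bool→ℤ-xor : ∀ p q →
  bool→ℤ (p xor q) ≡ bool→ℤ p +ℤ bool→ℤ q +ℤ -[1+ 1 ] *ℤ (bool→ℤ p *ℤ bool→ℤ q)
bool→ℤ-xor false false = refl
bool→ℤ-xor false true  = refl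
bool→ℤ-xor true  false = refl
bool→ℤ-xor true  true  = refl

⊕-represents : ∀ {k n} {a : BVec k → ℤ} {b : BVec n → ℤ} {f g} → Extensional a →
  Represents a f → Represents b g → Represents (a ⊕ b) (λ z → f (take k z) xor g (drop k z))
⊕-represents {k} {a = a} {b} {f} {g} a-ext a-rep b-rep z = begin
  evalPoly (a ⊕ b) z
    ≡⟨ evalPoly-+ (λ S → (a ⊗ one) S +ℤ (one ⊗ b) S) _ z ⟩
  evalPoly (λ S → (a ⊗ one) S +ℤ (one ⊗ b) S) z +ℤ evalPoly (λ S → -[1+ 1 ] *ℤ (a ⊗ b) S) z
    ≡⟨ cong₂ _+ℤ_ (evalPoly-+ (a ⊗ one) (one ⊗ b) z) (evalPoly-*ˡ -[1+ 1 ] (a ⊗ b) z) ⟩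
  evalPoly (a ⊗ one) z +ℤ evalPoly (one ⊗ b) z +ℤ -[1+ 1 ] *ℤ evalPoly (a ⊗ b) z
    ≡⟨ cong₂ _+ℤ_ (cong₂ _+ℤ_ (evalPoly-⊗ k a-ext one z) (evalPoly-⊗ k one-ext b z))
                  (cong (-[1+ 1 ] *ℤ_) (evalPoly-⊗ k a-ext b z)) ⟩
  A *ℤ evalPoly one (drop k z) +ℤ evalPoly one (take k z) *ℤ B +ℤ -[1+ 1 ] *ℤ (A *ℤ B)
    ≡⟨ cong₂ (λ p q → A *ℤ p +ℤ q *ℤ B +ℤ -[1+ 1 ] *ℤ (A *ℤ B))
             (evalPoly-one (drop k z)) (evalPoly-one (take k z)) ⟩
  A *ℤ 1ℤ +ℤ 1ℤ *ℤ B +ℤ -[1+ 1 ] *ℤ (A *ℤ B)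
    ≡⟨ cong₂ (λ p q → p +ℤ q +ℤ -[1+ 1 ] *ℤ (A *ℤ B)) (ℤP.*-identityʳ A) (ℤP.*-identityˡ B) ⟩
  A +ℤ B +ℤ -[1+ 1 ] *ℤ (A *ℤ B)
    ≡⟨ cong₂ (λ p q → p +ℤ q +ℤ -[1+ 1 ] *ℤ (p *ℤ q)) (a-rep (take k z)) (b-rep (drop k z)) ⟩
  F +ℤ G +ℤ -[1+ 1 ] *ℤ (F *ℤ G)
    ≡⟨ sym (bool→ℤ-xor (f (take k z)) (g (drop k z))) ⟩
  bool→ℤ (f (take k z) xor g (drop k z)) ∎
  where
  open ≡-Reasoning
  A = evalPoly a (take k z)
  B = evalPoly b (drop k z)
  F = bool→ℤ (f (take k z))
  G = bool→ℤ (g (drop k z))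

DegreeAtMost : ∀ {n} → (BVec n → ℤ) → ℕ → Set
DegreeAtMost c d = ∀ S → c S ≢ 0ℤ → hw S ≤ d

HasDegree : ∀ {n} → (BVec n → ℤ) → ℕ → Set
HasDegree c d = (∃[ S ] (c S ≢ 0ℤ × hw S ≡ d)) × DegreeAtMost c d

DegreeAtMost-mono : ∀ {n} {c : BVec n → ℤ} {d d′} → d ≤ d′ → DegreeAtMost c d → DegreeAtMost c d′
DegreeAtMost-mono d≤d′ c-deg S c≢0 = ℕP.≤-trans (c-deg S c≢0) d≤d′

DegreeAtMost-+ : ∀ {n} {a b : BVec n → ℤ} {d} →
  DegreeAtMost a d → DegreeAtMost b d → DegreeAtMost (λ S → a S +ℤ b S) d
DegreeAtMost-+ {a = a} a-deg b-deg S a+b≢0 with a S ℤ.≟ 0ℤ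
... | yes a≡0 = b-deg S (λ b≡0 → a+b≢0 (cong₂ _+ℤ_ a≡0 b≡0))
... | no  a≢0 = a-deg S a≢0

DegreeAtMost-*ˡ : ∀ {n} {c : BVec n → ℤ} {d} k → DegreeAtMost c d → DegreeAtMost (λ S → k *ℤ c S) d
DegreeAtMost-*ˡ k c-deg S kc≢0 = c-deg S (λ c≡0 → kc≢0 (trans (cong (k *ℤ_) c≡0) (ℤP.*-zeroʳ k)))

⊗-degreeAtMost : ∀ {k n} {a : BVec k → ℤ} {b : BVec n → ℤ} {dA dB} →
  DegreeAtMost a dA → DegreeAtMost b dB → DegreeAtMost (a ⊗ b) (dA + dB)
⊗-degreeAtMost {k} {a = a} {b} a-deg b-deg S ab≢0 =
  subst (_≤ _) (sym (hw-take-drop k S))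
    (ℕP.+-mono-≤ (a-deg (take k S) (λ a≡0 → ab≢0 (cong (_*ℤ b (drop k S)) a≡0)))
                 (b-deg (drop k S) (λ b≡0 → ab≢0 (trans (cong (a (take k S) *ℤ_) b≡0) (ℤP.*-zeroʳ (a (take k S)))))))

one-degreeAtMost : ∀ {n} → DegreeAtMost (one {n}) 0
one-degreeAtMost S one≢0 with hw S ℕP.≟ 0
... | yes hw≡0 = ℕP.≤-reflexive hw≡0
... | no  hw≢0 = contradiction (one-≡0 S hw≢0) one≢0

⊕-degreeAtMost : ∀ {k n} {a : BVec k → ℤ} {b : BVec n → ℤ} {dA dB} →
  DegreeAtMost a dA → DegreeAtMost b dB → DegreeAtMost (a ⊕ b) (dA + dB)
⊕-degreeAtMost {dA = dA} {dB} a-deg b-deg =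
  DegreeAtMost-+
    (DegreeAtMost-+ (DegreeAtMost-mono (ℕP.+-monoʳ-≤ dA z≤n) (⊗-degreeAtMost a-deg one-degreeAtMost))
                    (DegreeAtMost-mono (ℕP.+-monoˡ-≤ dB z≤n) (⊗-degreeAtMost one-degreeAtMost b-deg)))
    (DegreeAtMost-*ˡ -[1+ 1 ] (⊗-degreeAtMost a-deg b-deg))

⊕-++ : ∀ {k n} {a : BVec k → ℤ} {b : BVec n → ℤ} → Extensional a → Extensional b →
  ∀ {S T} → hw S ≢ 0 → hw T ≢ 0 → (a ⊕ b) (S ++ T) ≡ -[1+ 1 ] *ℤ (a S *ℤ b T)
⊕-++ {k} {a = a} {b} a-ext b-ext {S} {T} hwS≢0 hwT≢0 = begin
  (a ⊕ b) (S ++ T)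
    ≡⟨ cong₂ (λ p q → p *ℤ one (drop k (S ++ T)) +ℤ one (take k (S ++ T)) *ℤ q +ℤ -[1+ 1 ] *ℤ (p *ℤ q))
             (a-ext (lookup-++ˡ S T)) (b-ext (lookup-++ʳ S T)) ⟩
  a S *ℤ one (drop k (S ++ T)) +ℤ one (take k (S ++ T)) *ℤ b T +ℤ -[1+ 1 ] *ℤ (a S *ℤ b T)
    ≡⟨ cong₂ (λ p q → a S *ℤ p +ℤ q *ℤ b T +ℤ -[1+ 1 ] *ℤ (a S *ℤ b T))
             (trans (one-ext (lookup-++ʳ S T)) (one-≡0 T hwT≢0))
             (trans (one-ext (lookup-++ˡ S T)) (one-≡0 S hwS≢0)) ⟩
  a S *ℤ 0ℤ +ℤ 0ℤ *ℤ b T +ℤ -[1+ 1 ] *ℤ (a S *ℤ b T)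
    ≡⟨ cancel (a S) (b T) ⟩
  -[1+ 1 ] *ℤ (a S *ℤ b T) ∎
  where
  open ≡-Reasoning
  cancel : ∀ p q → p *ℤ 0ℤ +ℤ 0ℤ *ℤ q +ℤ -[1+ 1 ] *ℤ (p *ℤ q) ≡ -[1+ 1 ] *ℤ (p *ℤ q)
  cancel = solve-∀

⊕-++-≢0 : ∀ {k n} {a : BVec k → ℤ} {b : BVec n → ℤ} → Extensional a → Extensional b →
  ∀ {S T} → a S ≢ 0ℤ → hw S ≢ 0 → b T ≢ 0ℤ → hw T ≢ 0 → (a ⊕ b) (S ++ T) ≢ 0ℤ
⊕-++-≢0 {a = a} a-ext b-ext aS≢0 hwS≢0 bT≢0 hwT≢0 a⊕b≡0
  with ℤP.i*j≡0⇒i≡0∨j≡0 -[1+ 1 ] (trans (sym (⊕-++ a-ext b-ext hwS≢0 hwT≢0)) a⊕b≡0)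
... | inj₁ ()
... | inj₂ ab≡0 with ℤP.i*j≡0⇒i≡0∨j≡0 (a _) ab≡0
...   | inj₁ aS≡0 = aS≢0 aS≡0
...   | inj₂ bT≡0 = bT≢0 bT≡0

⊕-degree : ∀ {k n} {a : BVec k → ℤ} {b : BVec n → ℤ} {dA dB} → Extensional a → Extensional b →
  HasDegree a dA → 1 ≤ dA → HasDegree b dB → 1 ≤ dB → HasDegree (a ⊕ b) (dA + dB)
⊕-degree a-ext b-ext ((S , aS≢0 , hwS≡dA) , a-deg) 1≤dA ((T , bT≢0 , hwT≡dB) , b-deg) 1≤dB =
  ( S ++ T
  , ⊕-++-≢0 a-ext b-ext aS≢0 (nonzero hwS≡dA 1≤dA) bT≢0 (nonzero hwT≡dB 1≤dB)
  , trans (hw-++ S T) (cong₂ _+_ hwS≡dA hwT≡dB) )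
  , ⊕-degreeAtMost a-deg b-deg
  where
  nonzero : ∀ {m d} → m ≡ d → 1 ≤ d → m ≢ 0
  nonzero refl 1≤d = ℕP.n>0⇒n≢0 1≤d

-- (B + 1) · k, defined so that a single block has exactly k variables (suc 0 * k is only k + 0).
blocks : ℕ → ℕ → ℕ
blocks k zero    = k
blocks k (suc B) = k + blocks k B

blocks-≡ : ∀ k B → blocks k B ≡ suc B * k
blocks-≡ k zero    = sym (ℕP.+-identityʳ k)
blocks-≡ k (suc B) = cong (k +_) (blocks-≡ k B)

blocks-≥ : ∀ k B → k ≤ blocks k B
blocks-≥ k zero    = ℕP.≤-refl
blocks-≥ k (suc B) = ℕP.m≤m+n k (blocks k B)

xorBlocks : ∀ {k} → (BVec k → Bool) → ∀ B → BVec (blocks k B) → Bool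
xorBlocks     h zero    = h
xorBlocks {k} h (suc B) z = h (take k z) xor xorBlocks h B (drop k z)

xorBlocksPoly : ∀ {k} → (BVec k → ℤ) → ∀ B → BVec (blocks k B) → ℤ
xorBlocksPoly c zero    = c
xorBlocksPoly c (suc B) = c ⊕ xorBlocksPoly c B

xorBlocksPoly-ext : ∀ {k} {c : BVec k → ℤ} → Extensional c → ∀ B → Extensional (xorBlocksPoly c B)
xorBlocksPoly-ext c-ext zero    = c-ext
xorBlocksPoly-ext c-ext (suc B) = ⊕-ext c-ext (xorBlocksPoly-ext c-ext B)

xorBlocksPoly-represents : ∀ {k} {c : BVec k → ℤ} {h} → Extensional c → Represents c h →
  ∀ B → Represents (xorBlocksPoly c B) (xorBlocks h B)
xorBlocksPoly-represents c-ext c-rep zero    = c-rep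
xorBlocksPoly-represents c-ext c-rep (suc B) =
  ⊕-represents {b = xorBlocksPoly _ B} c-ext c-rep (xorBlocksPoly-represents c-ext c-rep B)

xorBlocksPoly-degree : ∀ {k} {c : BVec k → ℤ} {d} → Extensional c → HasDegree c d → 1 ≤ d →
  ∀ B → HasDegree (xorBlocksPoly c B) (blocks d B)
xorBlocksPoly-degree c-ext c-deg 1≤d zero    = c-deg
xorBlocksPoly-degree {d = d} c-ext c-deg 1≤d (suc B) =
  ⊕-degree c-ext (xorBlocksPoly-ext c-ext B) c-deg 1≤d (xorBlocksPoly-degree c-ext c-deg 1≤d B)
           (ℕP.≤-trans 1≤d (blocks-≥ d B))

flipAt-≢ : ∀ {m} {i j : Fin m} → i ≢ j → flipAt i j ≡ true
flipAt-≢ {i = i} {j} i≢j = cong not (dec-false (i Fin.≟ j) i≢j)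

flipAt-injective : ∀ {m n} (f : Fin m → Fin n) → (∀ {i j} → f i ≡ f j → i ≡ j) →
  ∀ i j → flipAt (f i) (f j) ≡ flipAt i j
flipAt-injective f f-inj i j = cong not (does-⇔ (mk⇔ f-inj (cong f)) (f i Fin.≟ f j) (i Fin.≟ j))

↑ˡ≢↑ʳ : ∀ {k n} (i : Fin k) (j : Fin n) → i ↑ˡ n ≢ k ↑ʳ j
↑ˡ≢↑ʳ {k} {n} i j eq with trans (sym (splitAt-↑ˡ k i n)) (trans (cong (splitAt k) eq) (splitAt-↑ʳ k n j))
... | ()

xorBlocks-ones : ∀ {k} {h : BVec k → Bool} → Extensional h → h ones ≡ false →
  ∀ B {v} → v ≗ ones → xorBlocks h B v ≡ false
xorBlocks-ones h-ext h-ones zero    v≗1 = trans (h-ext v≗1) h-ones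
xorBlocks-ones {k} h-ext h-ones (suc B) v≗1 =
  cong₂ _xor_ (trans (h-ext (v≗1 ∘ (_↑ˡ _))) h-ones) (xorBlocks-ones h-ext h-ones B (v≗1 ∘ (k ↑ʳ_)))

xorBlocks-flipAt : ∀ {k} {h : BVec k → Bool} →
  Extensional h → h ones ≡ false → (∀ i → h (flipAt i) ≡ true) →
  ∀ B i {v} → v ≗ flipAt i → xorBlocks h B v ≡ true
xorBlocks-flipAt h-ext h-ones h-flip zero    i v≗e = trans (h-ext v≗e) (h-flip i)
xorBlocks-flipAt {k} h-ext h-ones h-flip (suc B) i {v} v≗e with splitAt k i in eq
... | inj₁ i′ rewrite sym (splitAt⁻¹-↑ˡ eq) = cong₂ _xor_
  (trans (h-ext (λ j → trans (v≗e (j ↑ˡ _)) (flipAt-injective (_↑ˡ _) (↑ˡ-injective _ _ _) i′ j))) (h-flip i′))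
  (xorBlocks-ones h-ext h-ones B (λ j → trans (v≗e (k ↑ʳ j)) (flipAt-≢ (↑ˡ≢↑ʳ i′ j))))
... | inj₂ i′ rewrite sym (splitAt⁻¹-↑ʳ eq) = cong₂ _xor_
  (trans (h-ext (λ j → trans (v≗e (j ↑ˡ _)) (flipAt-≢ (↑ˡ≢↑ʳ j i′ ∘ sym)))) h-ones)
  (xorBlocks-flipAt h-ext h-ones h-flip B i′
    (λ j → trans (v≗e (k ↑ʳ j)) (flipAt-injective (k ↑ʳ_) (↑ʳ-injective k _ _) i′ j)))

bit₀ : BVec 1 → Bool
bit₀ x = x Fin.zero

bit₀Poly : BVec 1 → ℤ
bit₀Poly S = bool→ℤ (S Fin.zero)

bit₀Poly-ext : Extensional bit₀Poly
bit₀Poly-ext u≗v = cong bool→ℤ (u≗v Fin.zero)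

bit₀Poly-represents : Represents bit₀Poly bit₀
bit₀Poly-represents x with x Fin.zero
... | false = refl
... | true  = refl

bit₀Poly-degree : HasDegree bit₀Poly 1
bit₀Poly-degree = (ones , (λ ()) , refl) , λ S _ → hw≤1 S
  where
  hw≤1 : (S : BVec 1) → hw S ≤ 1
  hw≤1 S with S Fin.zero
  ... | false = z≤n
  ... | true  = s≤s z≤n

dot-ones : ∀ m (y : BVec (blocks 1 m)) → dot ones y ≡ xorBlocks bit₀ m y
dot-ones zero    y with y Fin.zero
... | false = refl
... | true  = refl
dot-ones (suc m) y = cong (y Fin.zero xor_) (dot-ones m (tail y))

nae₃ : Bool → Bool → Bool → Bool
nae₃ true  true  true  = false
nae₃ false false false = false
nae₃ _     _     _     = true

nae : BVec 3 → Bool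
nae x = nae₃ (x Fin.zero) (x (Fin.suc Fin.zero)) (x (Fin.suc (Fin.suc Fin.zero)))

-- NAE(x₀, x₁, x₂) = x₀ + x₁ + x₂ - x₀x₁ - x₀x₂ - x₁x₂
naeCoefficient : ℕ → ℤ
naeCoefficient 1 = 1ℤ
naeCoefficient 2 = -1ℤ
naeCoefficient _ = 0ℤ

naePoly : BVec 3 → ℤ
naePoly S = naeCoefficient (hw S)

nae-ext : Extensional nae
nae-ext u≗v rewrite u≗v Fin.zero | u≗v (Fin.suc Fin.zero) | u≗v (Fin.suc (Fin.suc Fin.zero)) = refl

naePoly-ext : Extensional naePoly
naePoly-ext u≗v = cong naeCoefficient (hw-ext u≗v)

naePoly-represents : Represents naePoly nae
naePoly-represents x with x Fin.zero | x (Fin.suc Fin.zero) | x (Fin.suc (Fin.suc Fin.zero))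
... | false | false | false = refl
... | false | false | true  = refl
... | false | true  | false = refl
... | false | true  | true  = refl
... | true  | false | false = refl
... | true  | false | true  = refl
... | true  | true  | false = refl
... | true  | true  | true  = refl

naePoly-degree : HasDegree naePoly 2
naePoly-degree = (flipAt (Fin.suc (Fin.suc Fin.zero)) , (λ ()) , refl) , λ S c≢0 → support (hw S) c≢0
  where
  support : ∀ m → naeCoefficient m ≢ 0ℤ → m ≤ 2
  support 0 c≢0 = contradiction refl c≢0
  support 1 _   = s≤s z≤n
  support 2 _   = s≤s (s≤s z≤n)
  support (suc (suc (suc m))) c≢0 = contradiction refl c≢0

nae-flipAt : ∀ i → nae (flipAt i) ≡ true
nae-flipAt Fin.zero                     = refl
nae-flipAt (Fin.suc Fin.zero)           = refl
nae-flipAt (Fin.suc (Fin.suc Fin.zero)) = refl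

isMM-constOnes : ∀ {n₁ n₂} {g : BVec n₁ → Bool} →
  n₂ % 2 ≡ 1 → g ones ≡ false → (∀ i → g (flipAt i) ≡ true) →
  IsMM n₁ n₂ (λ _ → ones) g
isMM-constOnes {n₂ = n₂} n₂-odd g-ones g-flipAt =
  (λ _ → refl) , g-ones , (λ _ → trans (cong (_% 2) (hw-ones n₂)) n₂-odd) ,
  (λ i → trans (cong bool→ℕ (g-flipAt i)) (sym n₂-odd))

mmFun-constOnes-pdeg : ∀ {n₁} m {g : BVec n₁ → Bool} {c d} →
  Extensional c → Represents c g → HasDegree c d → 1 ≤ d →
  HasPDeg (mmFun n₁ (blocks 1 m) (λ _ → ones) g) (d + blocks 1 m)
mmFun-constOnes-pdeg {n₁} m {g} {c} c-ext c-rep c-deg 1≤d =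
  c ⊕ parityPoly , represents ,
  ⊕-degree c-ext (xorBlocksPoly-ext bit₀Poly-ext m) c-deg 1≤d
           (xorBlocksPoly-degree bit₀Poly-ext bit₀Poly-degree ℕP.≤-refl m) (blocks-≥ 1 m)
  where
  parityPoly = xorBlocksPoly bit₀Poly m
  represents : Represents (c ⊕ parityPoly) (mmFun n₁ (blocks 1 m) (λ _ → ones) g)
  represents z = trans
    (⊕-represents {b = parityPoly} c-ext c-rep (xorBlocksPoly-represents bit₀Poly-ext bit₀Poly-represents m) z)
    (cong bool→ℤ (trans (xor-comm (g (take n₁ z)) _) (cong (_xor g (take n₁ z)) (sym (dot-ones m (drop n₁ z))))))

naeBlocksMM : ∀ B q →
  IsMM (blocks 3 B) (blocks 1 (q * 2)) (λ _ → ones) (xorBlocks nae B)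
  × HasPDeg (mmFun (blocks 3 B) (blocks 1 (q * 2)) (λ _ → ones) (xorBlocks nae B)) (blocks 2 B + blocks 1 (q * 2))
naeBlocksMM B q =
  isMM-constOnes {g = xorBlocks nae B} odd (xorBlocks-ones nae-ext refl B (λ _ → refl))
                 (λ i → xorBlocks-flipAt nae-ext refl nae-flipAt B i (λ _ → refl)) ,
  mmFun-constOnes-pdeg (q * 2) (xorBlocksPoly-ext naePoly-ext B)
    (xorBlocksPoly-represents naePoly-ext naePoly-represents B)
    (xorBlocksPoly-degree naePoly-ext naePoly-degree (s≤s z≤n) B) (ℕP.≤-trans (s≤s z≤n) (blocks-≥ 2 B))
  where
  odd : blocks 1 (q * 2) % 2 ≡ 1
  odd = trans (cong (_% 2) (trans (blocks-≡ 1 (q * 2)) (ℕP.*-identityʳ (suc (q * 2))))) ([m+kn]%n≡m%n 1 q 2)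

blocks-deficit : ∀ B p → blocks 3 B + p ∸ (blocks 2 B + p) ≡ suc B
blocks-deficit B p rewrite blocks-≡ 3 B | blocks-≡ 2 B =
  trans (cong (_∸ (suc B * 2 + p)) (split B p)) (ℕP.m+n∸n≡m (suc B) (suc B * 2 + p))
  where
  split : ∀ B p → suc B * 3 + p ≡ suc B + (suc B * 2 + p)
  split = solveℕ-∀

even-or-odd : ∀ r → ∃[ q ] (r ≡ q * 2 ⊎ r ≡ suc (q * 2))
even-or-odd zero = 0 , inj₁ refl
even-or-odd (suc r) with even-or-odd r
... | q , inj₁ r≡2q   = q , inj₂ (cong suc r≡2q)
... | q , inj₂ r≡2q+1 = suc q , inj₁ (cong suc r≡2q+1)

blocks-layout : ∀ B m → blocks 3 B + blocks 1 m ≡ 3 * suc B + suc m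
blocks-layout B m rewrite blocks-≡ 3 B | blocks-≡ 1 m = normalise B m
  where
  normalise : ∀ B m → suc B * 3 + suc m * 1 ≡ 3 * suc B + suc m
  normalise = solveℕ-∀

oddLayout : ∀ L r →
  ∃[ B ] ∃[ q ] (3 * suc L + 4 + r ≡ blocks 3 B + blocks 1 (q * 2)) × suc L ≤ suc B × B ≤ suc L
oddLayout L r with even-or-odd r
... | q , inj₁ refl =
  suc L , q , trans (even L q) (sym (blocks-layout (suc L) (q * 2))) , ℕP.n≤1+n (suc L) , ℕP.≤-refl
  where
  even : ∀ L q → 3 * suc L + 4 + q * 2 ≡ 3 * suc (suc L) + suc (q * 2)
  even = solveℕ-∀
... | q , inj₂ refl =
  L , suc (suc q) , trans (odd L q) (sym (blocks-layout L (suc (suc q) * 2))) , ℕP.≤-refl , ℕP.n≤1+n L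
  where
  odd : ∀ L q → 3 * suc L + 4 + suc (q * 2) ≡ 3 * suc L + suc (suc (suc q) * 2)
  odd = solveℕ-∀

blockDecomposition : ∀ n L → 1 ≤ L → 3 * L + 4 ≤ n →
  ∃[ B ] ∃[ q ] (n ≡ blocks 3 B + blocks 1 (q * 2)) × L ≤ suc B × suc B ≤ 2 * L
blockDecomposition n (suc ℓ) _ 3L+4≤n =
  let B , q , layout , ℓ+1≤B+1 , B≤ℓ+1 = oddLayout ℓ (n ∸ (3 * suc ℓ + 4))
  in  B , q , trans (sym (ℕP.m+[n∸m]≡n 3L+4≤n)) layout , ℓ+1≤B+1 , ℕP.≤-trans (s≤s B≤ℓ+1) (2+ℓ≤2[1+ℓ] ℓ)
  where
  2+ℓ≤2[1+ℓ] : ∀ ℓ → suc (suc ℓ) ≤ 2 * suc ℓ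
  2+ℓ≤2[1+ℓ] ℓ = subst (suc (suc ℓ) ≤_) (sym (ℕP.*-suc 2 ℓ)) (s≤s (s≤s (ℕP.m≤n*m ℓ 2)))

2*⌊n/2⌋≤n : ∀ n → 2 * ⌊ n /2⌋ ≤ n
2*⌊n/2⌋≤n zero          = z≤n
2*⌊n/2⌋≤n (suc zero)    = z≤n
2*⌊n/2⌋≤n (suc (suc n)) = subst (_≤ suc (suc n)) (sym (ℕP.*-suc 2 ⌊ n /2⌋)) (s≤s (s≤s (2*⌊n/2⌋≤n n)))

2^⌊log2⌋[1+n]≤1+n : ∀ n (rec : Acc _<_ (suc n)) → 2 ^ ⌊log2⌋ (suc n) rec ≤ suc n
2^⌊log2⌋[1+n]≤1+n zero    _        = ℕP.≤-refl
2^⌊log2⌋[1+n]≤1+n (suc n) (acc rs) =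
  ℕP.≤-trans (ℕP.*-monoʳ-≤ 2 (2^⌊log2⌋[1+n]≤1+n ⌊ n /2⌋ _)) (2*⌊n/2⌋≤n (suc (suc n)))

2^⌊log₂n⌋≤n : ∀ n → 1 ≤ n → 2 ^ ⌊log₂ n ⌋ ≤ n
2^⌊log₂n⌋≤n (suc n) _ = 2^⌊log2⌋[1+n]≤1+n n _

3*[4+k]+4≤2^[4+k] : ∀ k → 3 * (4 + k) + 4 ≤ 2 ^ (4 + k)
3*[4+k]+4≤2^[4+k] zero    = ℕP.≤-refl
3*[4+k]+4≤2^[4+k] (suc k) = begin
  3 * (5 + k) + 4                   ≤⟨ ℕP.m≤m+n _ (3 * k + 13) ⟩
  3 * (5 + k) + 4 + (3 * k + 13)    ≡⟨ double k ⟩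
  2 * (3 * (4 + k) + 4)             ≤⟨ ℕP.*-monoʳ-≤ 2 (3*[4+k]+4≤2^[4+k] k) ⟩
  2 ^ (5 + k)                       ∎
  where
  open ℕP.≤-Reasoning
  double : ∀ k → 3 * (5 + k) + 4 + (3 * k + 13) ≡ 2 * (3 * (4 + k) + 4)
  double = solveℕ-∀

4≤⌊log₂n⌋ : ∀ {n} → 16 ≤ n → 4 ≤ ⌊log₂ n ⌋
4≤⌊log₂n⌋ = ⌊log₂⌋-mono-≤

3*⌊log₂n⌋+4≤n : ∀ n → 16 ≤ n → 3 * ⌊log₂ n ⌋ + 4 ≤ n
3*⌊log₂n⌋+4≤n n 16≤n =
  ℕP.≤-trans (subst (λ L → 3 * L + 4 ≤ 2 ^ L) (ℕP.m+[n∸m]≡n (4≤⌊log₂n⌋ 16≤n))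
                    (3*[4+k]+4≤2^[4+k] (⌊log₂ n ⌋ ∸ 4)))
             (2^⌊log₂n⌋≤n n (ℕP.≤-trans (s≤s z≤n) 16≤n))

mainTheorem13 : ∃[ a ] ∃[ b ] ∃[ n₀ ] ∀ n → n₀ ≤ n →
    ∃[ n₁ ] ∃[ n₂ ] (n₁ + n₂ ≡ n) ×
      (∃[ φ ] ∃[ g ] IsMM n₁ n₂ φ g ×
        (∃[ d ] HasPDeg (mmFun n₁ n₂ φ g) d
          × ⌊log₂ n ⌋ ≤ a * (n ∸ d)
          × n ∸ d ≤ b * ⌊log₂ n ⌋))
mainTheorem13 = 1 , 2 , 16 , λ n 16≤n →
  let L = ⌊log₂ n ⌋
      B , q , n≡ , L≤B+1 , B+1≤2L =
        blockDecomposition n L (ℕP.≤-trans (s≤s z≤n) (4≤⌊log₂n⌋ 16≤n)) (3*⌊log₂n⌋+4≤n n 16≤n)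
      n₂ = blocks 1 (q * 2)
      d = blocks 2 B + n₂
      isMM , pdeg = naeBlocksMM B q
      n∸d≡B+1 = trans (cong (_∸ d) n≡) (blocks-deficit B n₂)
  in  blocks 3 B , n₂ , sym n≡ , (λ _ → ones) , xorBlocks nae B , isMM , d , pdeg ,
      subst (λ m → L ≤ 1 * m) (sym n∸d≡B+1) (subst (L ≤_) (sym (ℕP.*-identityˡ (suc B))) L≤B+1) ,
      subst (_≤ 2 * L) (sym n∸d≡B+1) B+1≤2L
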